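{- Let $n\ge2$ and $\pi,\tau\in S_n$. Then $\pi\sim\tau$ if and only if there exist $\sigma,\rho\in S_{n-1}$ such that $P_{\rho^{ -1}}L(\pi)P_\sigma=L(\tau)$.
   Context: For $x=(x_1,\dots,x_{n-1})\in\mathbb{R}^{n-1}$ put $Z_0=0$ and $Z_i=x_1+\dots+x_i$. If $Z_0,\dots,Z_{n-1}$ are pairwise distinct, let $p(x)\in S_n$ be the permutation with the same relative order as $(Z_0,\dots,Z_{n-1})$, i.e. $p(x)(i)=|\{k: Z_k\le Z_{i-1}\}|$; otherwise $p(x)$ is undefined (and "$p(x)=\pi$" is false). Write $\pi\sim\tau$ if there is $\rho\in S_{n-1}$ such that for all $x\in\mathbb{R}^{n-1}$: $p(x_1,\dots,x_{n-1})=\pi$ iff $p(x_{\rho(1)},\dots,x_{\rho(n-1)})=\tau$. For $\pi\in S_n$, $L(\pi)$ is the $(n-1)\times(n-1)$ matrix with $(L(\pi))_{ij}=\operatorname{sgn}(\pi(i+1)-\pi(i))$ if $\min(\pi(i),\pi(i+1))\le j<\max(\pi(i),\pi(i+1))$ and $0$ otherwise. For $\rho\in S_{n-1}$, $P_\rho$ is the permutation matrix with $(P_\rho)_{ij}=1$ if $\rho(i)=j$ and $0$ otherwise.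
   Formalization: The vectors x in the relation $\pi\sim\tau$ have rational coordinates rather than real ones. -}

module Defs where

open import Data.Nat as ℕ using (ℕ; zero; suc; _<ᵇ_; _≤ᵇ_)
open import Data.Bool using (Bool; true; false; if_then_else_; _∧_)
open import Data.Fin using (Fin; toℕ; inject₁) renaming (suc to fsuc; zero to fzero)
open import Data.Fin.Permutation using (Permutation′; _⟨$⟩ʳ_; flip)
open import Data.List using (List; length; filter; allFin)
open import Data.Rational as ℚ using (ℚ; 0ℚ)
open import Data.Rational.Properties using (_≤?_)
open import Data.Integer as ℤ using (ℤ; 0ℤ; 1ℤ; -1ℤ)
open import Data.Product using (Σ; _×_; _,_; ∃)
open import Relation.Binary.PropositionalEquality using (_≡_)

ΣFin : ∀ {k} → (Fin k → ℚ) → ℚ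
ΣFin {zero} f = 0ℚ
ΣFin {suc k} f = f fzero ℚ.+ ΣFin (λ i → f (fsuc i))

ΣFinℤ : ∀ {k} → (Fin k → ℤ) → ℤ
ΣFinℤ {zero} f = 0ℤ
ΣFinℤ {suc k} f = f fzero ℤ.+ ΣFinℤ (λ i → f (fsuc i))

-- Partial sums (0-based): Z k = x_0 + ... + x_{k-1}, so Z 0 = 0 and Z m = total.
-- (Paper: Z_0 = 0, Z_i = x_1 + ... + x_i.)
Z : ∀ {m} → (Fin m → ℚ) → Fin (suc m) → ℚ
Z x k = ΣFin (λ j → if toℕ j <ᵇ toℕ k then x j else 0ℚ)

countLe : ∀ {n} → (Fin n → ℚ) → Fin n → ℕ
countLe {n} z i = length (filter (λ k → z k ≤? z i) (allFin n))

-- "p(x) = π": the Z_k are pairwise distinct and p(x)(i) = |{k : Z_k ≤ Z_i}|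
-- (0-based values: π(i) + 1 = |{k : Z_k ≤ Z_i}|).
PEq : ∀ {m} → (Fin m → ℚ) → Permutation′ (suc m) → Set
PEq x π = (∀ i j → Z x i ≡ Z x j → i ≡ j)
        × (∀ i → countLe (Z x) i ≡ suc (toℕ (π ⟨$⟩ʳ i)))

_∼_ : ∀ {m} → Permutation′ (suc m) → Permutation′ (suc m) → Set
_∼_ {m} π τ = Σ (Permutation′ m) λ ρ → ∀ (x : Fin m → ℚ) →
  (PEq x π → PEq (λ i → x (ρ ⟨$⟩ʳ i)) τ) × (PEq (λ i → x (ρ ⟨$⟩ʳ i)) τ → PEq x π)

Matrix : ℕ → Set
Matrix m = Fin m → Fin m → ℤ

_·_ : ∀ {m} → Matrix m → Matrix m → Matrix m
(A · B) i k = ΣFinℤ (λ j → A i j ℤ.* B j k)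

-- L(π)_{ij} = sgn(π(i+1) − π(i)) if min(π(i),π(i+1)) ≤ j < max(π(i),π(i+1)), else 0
-- (0-based rows/columns and values; the condition is shift-invariant).
L : ∀ {m} → Permutation′ (suc m) → Matrix m
L π i j =
  let a = toℕ (π ⟨$⟩ʳ inject₁ i)
      b = toℕ (π ⟨$⟩ʳ fsuc i)
      c = toℕ j
  in if a <ᵇ b then (if (a ≤ᵇ c) ∧ (c <ᵇ b) then 1ℤ else 0ℤ)
               else (if (b ≤ᵇ c) ∧ (c <ᵇ a) then -1ℤ else 0ℤ)

P : ∀ {m} → Permutation′ m → Matrix m
P ρ i j = if toℕ (ρ ⟨$⟩ʳ i) ℕ.≡ᵇ toℕ j then 1ℤ else 0ℤ

_⁻¹ : ∀ {m} → Permutation′ m → Permutation′ m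
ρ ⁻¹ = flip ρ

_≋_ : ∀ {m} → Matrix m → Matrix m → Set
A ≋ B = ∀ i j → A i j ≡ B i j

{-# OPTIONS --safe #-}
module Submission where

-- Let Y be the partial sums of y. Row i of L(π) y is Y_{π(i+1)} − Y_{π(i)}, so the partial
-- sums of x = L(π) y are Z_k = Y_{π(k)} − Y_{π(0)}; for y > 0 the Y_k increase and p(x) = π.
-- Conversely y is recovered from x as the gaps between consecutive sorted partial sums, which
-- are positive when p(x) = π. So {x | p(x) = π} is the open simplicial cone L(π) ℚ_{>0}^{n−1}
-- and L(π) is invertible.
--
-- If P_{ρ⁻¹} L(π) P_σ = L(τ), reindexing coordinates by ρ⁻¹ maps the cone of π onto that of τ.
-- Conversely, if reindexing by ρ (call it R) maps one cone onto the other, then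
-- W = L(τ)⁻¹ R L(π) and its inverse both preserve the closed positive orthant, so every column
-- of W is a positive multiple of a unit vector: R sends each column of L(π) to a positive
-- multiple of a column of L(τ). As all entries lie in {−1, 0, 1} the multiple is 1, and the
-- induced map on columns is the permutation σ.

open import Defs
open import Data.Nat as ℕ using (ℕ; zero; suc; _<ᵇ_; _≤ᵇ_; s≤s; z≤n)
import Data.Nat.Properties as ℕ
open import Data.Bool using (Bool; true; false; if_then_else_; not; _∧_; T)
open import Data.Unit using (tt)
open import Data.Fin as Fin using (Fin; toℕ; inject₁) renaming (zero to fzero; suc to fsuc)
import Data.Fin.Properties as Fin
open import Data.Fin.Induction using (<-weakInduction)
open import Data.Fin.Permutation using (Permutation′; _⟨$⟩ʳ_; _⟨$⟩ˡ_; flip; inverseˡ; inverseʳ; permutation)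
open import Data.Integer as ℤ using (ℤ; 0ℤ; 1ℤ; -1ℤ)
import Data.Integer.Properties as ℤ
open import Data.Integer.GCD using (gcd; gcd-zeroʳ)
open import Data.Rational as ℚ using (ℚ; 0ℚ; 1ℚ; _+_; _*_; -_; _-_; _≤_; _<_; _/_; ↥_)
import Data.Rational.Properties as ℚ
open import Data.Rational.Solver using (module +-*-Solver)
open import Algebra.Bundles using (CommutativeRing; Semiring)
open import Algebra.Properties.Ring ℚ.+-*-ring using (-1*x≈-x)
import Algebra.Properties.Semiring.Sum as SemiringSum
import Algebra.Properties.CommutativeMonoid.Sum as MonoidSum
open import Data.Product using (Σ; ∃; _×_; _,_; proj₁; proj₂)
open import Data.Sum using (_⊎_; inj₁; inj₂)
open import Data.Empty using (⊥-elim)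
open import Function using (_∘_; id)
open import Data.Vec.Functional using (removeAt)
open import Level using (0ℓ)
open import Data.List using (length; filter; tabulate; allFin)
open import Data.List.Properties using (filter-≐)
open import Data.List.Relation.Binary.Sublist.Propositional.Properties using (filter⁺; length-mono-≤)
open import Data.List.Relation.Binary.Sublist.Propositional using (⊆-refl)
open import Relation.Unary using (Pred; Decidable)
open import Relation.Binary.Definitions using (tri<; tri≈; tri>)
open import Relation.Nullary using (¬_; yes; no; does)
open import Relation.Nullary.Decidable using (dec-true; dec-false)
open import Relation.Binary.PropositionalEquality
  using (_≡_; _≢_; _≗_; refl; sym; trans; cong; cong₂; subst; subst₂; module ≡-Reasoning)

module _ {r ℓ} (R : Semiring r ℓ) where
  open Semiring R using (Carrier; _≈_; 0#; +-congˡ; +-congʳ; +-identityˡ; +-identityʳ; setoid) renaming (_+_ to _⊕_)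
  open SemiringSum R using (sum; sum-cong-≋; sum-replicate-zero)
  open import Relation.Binary.Reasoning.Setoid setoid

  sum-single : ∀ {n} (c : Fin n) (f : Fin n → Carrier) → (∀ k → k ≢ c → f k ≈ 0#) → sum f ≈ f c
  sum-single {suc n} fzero f h = begin
    f fzero ⊕ sum (f ∘ fsuc) ≈⟨ +-congˡ (sum-cong-≋ (λ k → h (fsuc k) λ ())) ⟩
    f fzero ⊕ sum {n} (λ _ → 0#) ≈⟨ +-congˡ (sum-replicate-zero n) ⟩
    f fzero ⊕ 0# ≈⟨ +-identityʳ (f fzero) ⟩
    f fzero ∎
  sum-single {suc n} (fsuc c) f h = begin
    f fzero ⊕ sum (f ∘ fsuc) ≈⟨ +-congʳ (h fzero λ ()) ⟩
    0# ⊕ sum (f ∘ fsuc) ≈⟨ +-identityˡ _ ⟩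
    sum (f ∘ fsuc) ≈⟨ sum-single c (f ∘ fsuc) (λ k k≢c → h (fsuc k) (k≢c ∘ Fin.suc-injective)) ⟩
    f (fsuc c) ∎

ℚ-semiring : Semiring 0ℓ 0ℓ
ℚ-semiring = CommutativeRing.semiring ℚ.+-*-commutativeRing

module ℚΣ = SemiringSum ℚ-semiring
module ℤΣ = SemiringSum ℤ.+-*-semiring
module ℕΣ = MonoidSum ℕ.+-0-commutativeMonoid

open ℚΣ using (sum; sum-syntax)

ΣFin≡sum : ∀ {n} (f : Fin n → ℚ) → ΣFin f ≡ sum f
ΣFin≡sum {zero} f = refl
ΣFin≡sum {suc n} f = cong (f fzero +_) (ΣFin≡sum (f ∘ fsuc))

ΣFinℤ≡sum : ∀ {n} (f : Fin n → ℤ) → ΣFinℤ f ≡ ℤΣ.sum f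
ΣFinℤ≡sum {zero} f = refl
ΣFinℤ≡sum {suc n} f = cong (λ s → f fzero ℤ.+ s) (ΣFinℤ≡sum (f ∘ fsuc))

sum-neg : ∀ {n} (f : Fin n → ℚ) → ∑[ j < n ] (- f j) ≡ - sum f
sum-neg f = begin
  sum (λ j → - f j)         ≡⟨ ℚΣ.sum-cong-≗ (λ j → -1*x≈-x (f j)) ⟨
  sum (λ j → - 1ℚ * f j)    ≡⟨ ℚΣ.*-distribˡ-sum (- 1ℚ) f ⟨
  - 1ℚ * sum f              ≡⟨ -1*x≈-x (sum f) ⟩
  - sum f                   ∎
  where open ≡-Reasoning

sum-nonNeg : ∀ {n} (f : Fin n → ℚ) → (∀ i → 0ℚ ≤ f i) → 0ℚ ≤ sum f
sum-nonNeg {zero} f _ = ℚ.≤-refl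
sum-nonNeg {suc n} f f≥0 = ℚ.+-mono-≤ (f≥0 fzero) (sum-nonNeg (f ∘ fsuc) (f≥0 ∘ fsuc))

nonNeg-sum≡0⇒≡0 : ∀ {n} (f : Fin n → ℚ) → (∀ i → 0ℚ ≤ f i) → sum f ≡ 0ℚ → ∀ i → f i ≡ 0ℚ
nonNeg-sum≡0⇒≡0 {suc n} f f≥0 sum≡0 i = ℚ.≤-antisym fi≤0 (f≥0 i)
  where
  open ℚ.≤-Reasoning
  rest : ℚ
  rest = ∑[ k < n ] removeAt f i k
  fi≤0 : f i ≤ 0ℚ
  fi≤0 = begin
    f i          ≡⟨ ℚ.+-identityʳ (f i) ⟨
    f i + 0ℚ     ≤⟨ ℚ.+-monoʳ-≤ (f i) (sum-nonNeg (removeAt f i) (f≥0 ∘ Fin.punchIn i)) ⟩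
    f i + rest   ≡⟨ ℚΣ.sum-remove f ⟨
    sum f        ≡⟨ sum≡0 ⟩
    0ℚ           ∎

sum≢0⇒∃≢0 : ∀ {n} (f : Fin n → ℚ) → sum f ≢ 0ℚ → ∃ λ i → f i ≢ 0ℚ
sum≢0⇒∃≢0 {n} f sum≢0 =
  Fin.¬∀⟶∃¬ n (λ i → f i ≡ 0ℚ) (λ i → f i ℚ.≟ 0ℚ)
    (λ f≗0 → sum≢0 (trans (ℚΣ.sum-cong-≗ f≗0) (ℚΣ.sum-replicate-zero n)))

𝟙 : Bool → ℚ
𝟙 b = if b then 1ℚ else 0ℚ

𝟙-* : ∀ b u → 𝟙 b * u ≡ (if b then u else 0ℚ)
𝟙-* true u = ℚ.*-identityˡ u
𝟙-* false u = ℚ.*-zeroˡ u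

length-filter-tabulate : ∀ {a p} {A : Set a} {P : Pred A p} (P? : Decidable P) {n} (f : Fin n → A) →
                         length (filter P? (tabulate f)) ≡ ℕΣ.sum (λ k → if does (P? (f k)) then 1 else 0)
length-filter-tabulate P? {zero} f = refl
length-filter-tabulate P? {suc n} f with does (P? (f fzero))
... | true = cong suc (length-filter-tabulate P? (f ∘ fsuc))
... | false = length-filter-tabulate P? (f ∘ fsuc)

count-≤ : ∀ {n} (v : Fin n) → ℕΣ.sum (λ (j : Fin n) → if does (j Fin.≤? v) then 1 else 0) ≡ suc (toℕ v)
count-≤ {suc n} fzero = cong suc (ℕΣ.sum-replicate-zero n)
count-≤ {suc n} (fsuc v) =
  cong suc (trans (ℕΣ.sum-cong-≗ {n} (λ j → cong (if_then 1 else 0) (≤ᵇ-suc (toℕ j) (toℕ v)))) (count-≤ v))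
  where
  ≤ᵇ-suc : ∀ a b → (suc a ≤ᵇ suc b) ≡ (a ≤ᵇ b)
  ≤ᵇ-suc zero b = refl
  ≤ᵇ-suc (suc a) b = refl

count-permute-≤ : ∀ {n} (π : Permutation′ n) (v : Fin n) →
                  length (filter (λ k → π ⟨$⟩ʳ k Fin.≤? v) (allFin n)) ≡ suc (toℕ v)
count-permute-≤ {n} π v = begin
  length (filter (λ k → π ⟨$⟩ʳ k Fin.≤? v) (allFin n))
    ≡⟨ length-filter-tabulate (λ k → π ⟨$⟩ʳ k Fin.≤? v) id ⟩
  ℕΣ.sum (λ k → if does (π ⟨$⟩ʳ k Fin.≤? v) then 1 else 0)
    ≡⟨ ℕΣ.∑-permute (λ (j : Fin n) → if does (j Fin.≤? v) then 1 else 0) π ⟨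
  ℕΣ.sum (λ (j : Fin n) → if does (j Fin.≤? v) then 1 else 0)
    ≡⟨ count-≤ v ⟩
  suc (toℕ v) ∎
  where open ≡-Reasoning

-- Partial sums and their differences

Z-as-sum : ∀ {m} (x : Fin m → ℚ) k → Z x k ≡ ∑[ j < m ] (if toℕ j <ᵇ toℕ k then x j else 0ℚ)
Z-as-sum x k = ΣFin≡sum (λ j → if toℕ j <ᵇ toℕ k then x j else 0ℚ)

Z-cong : ∀ {m} {x y : Fin m → ℚ} → x ≗ y → Z x ≗ Z y
Z-cong {x = x} {y} x≗y k = begin
  Z x k                                           ≡⟨ Z-as-sum x k ⟩
  ∑[ j < _ ] (if toℕ j <ᵇ toℕ k then x j else 0ℚ)
    ≡⟨ ℚΣ.sum-cong-≗ (λ j → cong (if toℕ j <ᵇ toℕ k then_else 0ℚ) (x≗y j)) ⟩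
  ∑[ j < _ ] (if toℕ j <ᵇ toℕ k then y j else 0ℚ) ≡⟨ Z-as-sum y k ⟨
  Z y k                                           ∎
  where open ≡-Reasoning

Z-zero : ∀ {m} (x : Fin m → ℚ) → Z x fzero ≡ 0ℚ
Z-zero {m} x = trans (Z-as-sum x fzero) (ℚΣ.sum-replicate-zero m)

Z-suc : ∀ {m} (x : Fin m → ℚ) j → Z x (fsuc j) ≡ Z x (inject₁ j) + x j
Z-suc {suc m} x fzero = begin
  x fzero + Z (x ∘ fsuc) fzero ≡⟨ cong (x fzero +_) (Z-zero (x ∘ fsuc)) ⟩
  x fzero + 0ℚ                 ≡⟨ ℚ.+-comm (x fzero) 0ℚ ⟩
  0ℚ + x fzero                 ≡⟨ cong (_+ x fzero) (Z-zero x) ⟨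
  Z x fzero + x fzero          ∎
  where open ≡-Reasoning
Z-suc {suc m} x (fsuc j) = begin
  x fzero + Z (x ∘ fsuc) (fsuc j)                ≡⟨ cong (x fzero +_) (Z-suc (x ∘ fsuc) j) ⟩
  x fzero + (Z (x ∘ fsuc) (inject₁ j) + x (fsuc j)) ≡⟨ ℚ.+-assoc (x fzero) (Z (x ∘ fsuc) (inject₁ j)) (x (fsuc j)) ⟨
  Z x (inject₁ (fsuc j)) + x (fsuc j)            ∎
  where open ≡-Reasoning

Z-linear : ∀ {m} t (a b : Fin m → ℚ) k → Z (λ i → t * a i + b i) k ≡ t * Z a k + Z b k
Z-linear {m} t a b k = begin
  Z (λ i → t * a i + b i) k                  ≡⟨ Z-as-sum _ k ⟩
  ∑[ j < m ] [ j ] (t * a j + b j)            ≡⟨ ℚΣ.sum-cong-≗ (λ j → masked (toℕ j <ᵇ toℕ k) (a j) (b j)) ⟩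
  ∑[ j < m ] (t * [ j ] (a j) + [ j ] (b j))  ≡⟨ ℚΣ.∑-distrib-+ (λ j → t * [ j ] (a j)) (λ j → [ j ] (b j)) ⟩
  ∑[ j < m ] (t * [ j ] (a j)) + ∑[ j < m ] [ j ] (b j)
    ≡⟨ cong₂ _+_ (ℚΣ.*-distribˡ-sum t (λ j → [ j ] (a j))) (Z-as-sum b k) ⟨
  t * ∑[ j < m ] [ j ] (a j) + Z b k          ≡⟨ cong (λ s → t * s + Z b k) (Z-as-sum a k) ⟨
  t * Z a k + Z b k                            ∎
  where
  open ≡-Reasoning
  [_]_ : Fin m → ℚ → ℚ
  [ j ] q = if toℕ j <ᵇ toℕ k then q else 0ℚ
  masked : ∀ c p q → (if c then t * p + q else 0ℚ) ≡ t * (if c then p else 0ℚ) + (if c then q else 0ℚ)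
  masked true p q = refl
  masked false p q = sym (trans (cong (_+ 0ℚ) (ℚ.*-zeroʳ t)) (ℚ.+-identityʳ 0ℚ))

Δ : ∀ {m} → (Fin (suc m) → ℚ) → Fin m → ℚ
Δ g j = g (fsuc j) - g (inject₁ j)

Δ-Z : ∀ {m} (x : Fin m → ℚ) → Δ (Z x) ≗ x
Δ-Z x j = trans (cong (_- Z x (inject₁ j)) (Z-suc x j))
                (solve 2 (λ p q → (p :+ q) :- p := q) refl (Z x (inject₁ j)) (x j))
  where open +-*-Solver

Z-Δ : ∀ {m} (g : Fin (suc m) → ℚ) k → Z (Δ g) k ≡ g k - g fzero
Z-Δ g = <-weakInduction (λ k → Z (Δ g) k ≡ g k - g fzero) base step
  where
  open ≡-Reasoning
  open +-*-Solver
  base : Z (Δ g) fzero ≡ g fzero - g fzero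
  base = trans (Z-zero (Δ g)) (sym (ℚ.+-inverseʳ (g fzero)))
  step : ∀ k → Z (Δ g) (inject₁ k) ≡ g (inject₁ k) - g fzero → Z (Δ g) (fsuc k) ≡ g (fsuc k) - g fzero
  step k ih = begin
    Z (Δ g) (fsuc k)                                               ≡⟨ Z-suc (Δ g) k ⟩
    Z (Δ g) (inject₁ k) + Δ g k                                    ≡⟨ cong (_+ Δ g k) ih ⟩
    (g (inject₁ k) - g fzero) + (g (fsuc k) - g (inject₁ k))
      ≡⟨ solve 3 (λ p q r → (p :- r) :+ (q :- p) := q :- r) refl (g (inject₁ k)) (g (fsuc k)) (g fzero) ⟩
    g (fsuc k) - g fzero                                           ∎

Δ-cong : ∀ {m} {g h : Fin (suc m) → ℚ} → g ≗ h → Δ g ≗ Δ h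
Δ-cong g≗h j = cong₂ _-_ (g≗h (fsuc j)) (g≗h (inject₁ j))

Δ-Z-Δ : ∀ {m} (g : Fin (suc m) → ℚ) (σ : Fin (suc m) → Fin (suc m)) →
        Δ (λ k → Z (Δ g) (σ k)) ≗ Δ (λ k → g (σ k))
Δ-Z-Δ g σ j = trans (Δ-cong (λ k → Z-Δ g (σ k)) j)
                    (solve 3 (λ p q r → (p :- r) :- (q :- r) := p :- q) refl (g (σ (fsuc j))) (g (σ (inject₁ j))) (g fzero))
  where open +-*-Solver

<-by-steps : ∀ {m} (g : Fin (suc m) → ℚ) → (∀ j → g (inject₁ j) < g (fsuc j)) →
             ∀ {a b} → a Fin.< b → g a < g b
<-by-steps {suc m} g step {fzero} {fsuc fzero} _ = step fzero
<-by-steps {suc m} g step {fzero} {fsuc (fsuc b)} _ =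
  ℚ.<-trans (step fzero) (<-by-steps (g ∘ fsuc) (step ∘ fsuc) {fzero} {fsuc b} (s≤s z≤n))
<-by-steps {suc m} g step {fsuc a} {fsuc b} (s≤s a<b) = <-by-steps (g ∘ fsuc) (step ∘ fsuc) a<b

Z-strictMono : ∀ {m} (y : Fin m → ℚ) → (∀ j → 0ℚ < y j) → ∀ {a b} → a Fin.< b → Z y a < Z y b
Z-strictMono y y>0 = <-by-steps (Z y) step
  where
  step : ∀ j → Z y (inject₁ j) < Z y (fsuc j)
  step j = subst₂ _<_ (ℚ.+-identityʳ _) (sym (Z-suc y j)) (ℚ.+-monoʳ-< (Z y (inject₁ j)) (y>0 j))

Ranks : ∀ {n} → Permutation′ n → (Fin n → ℚ) → Set
Ranks π z = ∀ a b → π ⟨$⟩ʳ a Fin.< π ⟨$⟩ʳ b → z a < z b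

permute-injective : ∀ {n} (π : Permutation′ n) {i j} → π ⟨$⟩ʳ i ≡ π ⟨$⟩ʳ j → i ≡ j
permute-injective π {i} {j} eq = trans (sym (inverseˡ π)) (trans (cong (π ⟨$⟩ˡ_) eq) (inverseˡ π))

module _ {n} {π : Permutation′ n} {z : Fin n → ℚ} (ranks : Ranks π z) where

  Ranks⇒injective : ∀ i j → z i ≡ z j → i ≡ j
  Ranks⇒injective i j zi≡zj with Fin.<-cmp (π ⟨$⟩ʳ i) (π ⟨$⟩ʳ j)
  ... | tri< πi<πj _ _ = ⊥-elim (ℚ.<-irrefl zi≡zj (ranks i j πi<πj))
  ... | tri≈ _ πi≡πj _ = permute-injective π πi≡πj
  ... | tri> _ _ πj<πi = ⊥-elim (ℚ.<-irrefl (sym zi≡zj) (ranks j i πj<πi))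

  Ranks⇒≤⇔≤ : ∀ k i → (z k ≤ z i → π ⟨$⟩ʳ k Fin.≤ π ⟨$⟩ʳ i) × (π ⟨$⟩ʳ k Fin.≤ π ⟨$⟩ʳ i → z k ≤ z i)
  Ranks⇒≤⇔≤ k i = ≤⇒≤ᶠ , ≤ᶠ⇒≤
    where
    ≤⇒≤ᶠ : z k ≤ z i → π ⟨$⟩ʳ k Fin.≤ π ⟨$⟩ʳ i
    ≤⇒≤ᶠ zk≤zi = ℕ.≮⇒≥ (λ πi<πk → ℚ.<-irrefl refl (ℚ.<-≤-trans (ranks i k πi<πk) zk≤zi))
    ≤ᶠ⇒≤ : π ⟨$⟩ʳ k Fin.≤ π ⟨$⟩ʳ i → z k ≤ z i
    ≤ᶠ⇒≤ πk≤πi with π ⟨$⟩ʳ k Fin.≟ π ⟨$⟩ʳ i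
    ... | yes πk≡πi = ℚ.≤-reflexive (cong z (permute-injective π πk≡πi))
    ... | no πk≢πi = ℚ.<⇒≤ (ranks k i (Fin.≤∧≢⇒< πk≤πi πk≢πi))

  Ranks⇒countLe : ∀ i → countLe z i ≡ suc (toℕ (π ⟨$⟩ʳ i))
  Ranks⇒countLe i = begin
    length (filter (λ k → z k ℚ.≤? z i) (allFin n))
      ≡⟨ cong length (filter-≐ (λ k → z k ℚ.≤? z i) (λ k → π ⟨$⟩ʳ k Fin.≤? π ⟨$⟩ʳ i)
                                ((λ {k} → proj₁ (Ranks⇒≤⇔≤ k i)) , (λ {k} → proj₂ (Ranks⇒≤⇔≤ k i))) (allFin n)) ⟩
    length (filter (λ k → π ⟨$⟩ʳ k Fin.≤? π ⟨$⟩ʳ i) (allFin n))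
      ≡⟨ count-permute-≤ π (π ⟨$⟩ʳ i) ⟩
    suc (toℕ (π ⟨$⟩ʳ i)) ∎
    where open ≡-Reasoning

countLe-mono : ∀ {n} (z : Fin n → ℚ) {a b} → z a ≤ z b → countLe z a ℕ.≤ countLe z b
countLe-mono z {a} {b} za≤zb =
  length-mono-≤ (filter⁺ (λ k → z k ℚ.≤? z a) (λ k → z k ℚ.≤? z b)
                         (λ { refl zk≤za → ℚ.≤-trans zk≤za za≤zb }) (⊆-refl {x = allFin _}))

countLe⇒Ranks : ∀ {n} {π : Permutation′ n} {z : Fin n → ℚ} →
                (∀ i → countLe z i ≡ suc (toℕ (π ⟨$⟩ʳ i))) → Ranks π z
countLe⇒Ranks {z = z} counts a b πa<πb with z b ℚ.≤? z a
... | yes zb≤za = ⊥-elim (ℕ.<⇒≱ πa<πb (ℕ.≤-pred (subst₂ ℕ._≤_ (counts b) (counts a) (countLe-mono z zb≤za))))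
... | no zb≰za = ℚ.≰⇒> zb≰za

PEq⇒Ranks : ∀ {m} {x : Fin m → ℚ} {π} → PEq x π → Ranks π (Z x)
PEq⇒Ranks {x = x} {π} (_ , counts) = countLe⇒Ranks {π = π} {z = Z x} counts

Ranks⇒PEq : ∀ {m} {x : Fin m → ℚ} {π} → Ranks π (Z x) → PEq x π
Ranks⇒PEq {x = x} {π} ranks = Ranks⇒injective {π = π} {z = Z x} ranks , Ranks⇒countLe {π = π} {z = Z x} ranks

PEq-cong : ∀ {m} {x y : Fin m → ℚ} {π} → x ≗ y → PEq x π → PEq y π
PEq-cong {π = π} x≗y pe = Ranks⇒PEq {π = π} λ a b πa<πb →
  subst₂ _<_ (Z-cong x≗y a) (Z-cong x≗y b) (PEq⇒Ranks {π = π} pe a b πa<πb)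

toℚ : ℤ → ℚ
toℚ z = z / 1

toℚ-injective : ∀ {a b} → toℚ a ≡ toℚ b → a ≡ b
toℚ-injective {a} {b} eq = trans (sym (↥-toℚ a)) (trans (cong ↥_ eq) (↥-toℚ b))
  where
  ↥-toℚ : ∀ z → ↥ toℚ z ≡ z
  ↥-toℚ z = begin
    ↥ toℚ z                  ≡⟨ ℤ.*-identityʳ _ ⟨
    ↥ toℚ z ℤ.* 1ℤ           ≡⟨ cong (↥ toℚ z ℤ.*_) (gcd-zeroʳ z) ⟨
    ↥ toℚ z ℤ.* gcd z 1ℤ     ≡⟨ ℚ.↥-/ z 1 ⟩
    z                        ∎
    where open ≡-Reasoning

_·ᵥ_ : ∀ {m} → Matrix m → (Fin m → ℚ) → Fin m → ℚ
(A ·ᵥ y) i = ∑[ j < _ ] (toℚ (A i j) * y j)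

col : ∀ {m} → Matrix m → Fin m → Fin m → ℚ
col A j i = toℚ (A i j)

δ : ∀ {m} → Fin m → Fin m → ℚ
δ j l = 𝟙 (does (j Fin.≟ l))

δ-diagonal : ∀ {m} (j : Fin m) → δ j j ≡ 1ℚ
δ-diagonal j = cong 𝟙 (dec-true (j Fin.≟ j) refl)

δ-off-diagonal : ∀ {m} {j l : Fin m} → j ≢ l → δ j l ≡ 0ℚ
δ-off-diagonal {j = j} {l} j≢l = cong 𝟙 (dec-false (j Fin.≟ l) j≢l)

·ᵥ-δ : ∀ {m} (A : Matrix m) j → A ·ᵥ δ j ≗ col A j
·ᵥ-δ A j i = begin
  (A ·ᵥ δ j) i             ≡⟨ sum-single ℚ-semiring j (λ l → toℚ (A i l) * δ j l) off-diagonal ⟩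
  toℚ (A i j) * δ j j      ≡⟨ cong (toℚ (A i j) *_) (δ-diagonal j) ⟩
  toℚ (A i j) * 1ℚ         ≡⟨ ℚ.*-identityʳ _ ⟩
  col A j i                ∎
  where
  open ≡-Reasoning
  off-diagonal : ∀ l → l ≢ j → toℚ (A i l) * δ j l ≡ 0ℚ
  off-diagonal l l≢j = trans (cong (toℚ (A i l) *_) (δ-off-diagonal (l≢j ∘ sym))) (ℚ.*-zeroʳ (toℚ (A i l)))

·ᵥ-linear : ∀ {m} (A : Matrix m) t (a b : Fin m → ℚ) →
            A ·ᵥ (λ l → t * a l + b l) ≗ (λ i → t * (A ·ᵥ a) i + (A ·ᵥ b) i)
·ᵥ-linear {m} A t a b i = begin
  ∑[ l < m ] (toℚ (A i l) * (t * a l + b l))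
    ≡⟨ ℚΣ.sum-cong-≗ (λ l → solve 4 (λ e t a b → e :* (t :* a :+ b) := t :* (e :* a) :+ e :* b) refl
                                        (toℚ (A i l)) t (a l) (b l)) ⟩
  ∑[ l < m ] (t * (toℚ (A i l) * a l) + toℚ (A i l) * b l)
    ≡⟨ ℚΣ.∑-distrib-+ (λ l → t * (toℚ (A i l) * a l)) (λ l → toℚ (A i l) * b l) ⟩
  ∑[ l < m ] (t * (toℚ (A i l) * a l)) + (A ·ᵥ b) i
    ≡⟨ cong (_+ (A ·ᵥ b) i) (ℚΣ.*-distribˡ-sum t (λ l → toℚ (A i l) * a l)) ⟨
  t * (A ·ᵥ a) i + (A ·ᵥ b) i ∎
  where
  open ≡-Reasoning
  open +-*-Solver

·ᵥ-combination : ∀ {m} (A : Matrix m) (c : Fin m → ℚ) (v : Fin m → Fin m → ℚ) →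
                 A ·ᵥ (λ l → ∑[ k < m ] (c k * v k l)) ≗ (λ i → ∑[ k < m ] (c k * (A ·ᵥ v k) i))
·ᵥ-combination {m} A c v i = begin
  ∑[ l < m ] (toℚ (A i l) * ∑[ k < m ] (c k * v k l))
    ≡⟨ ℚΣ.sum-cong-≗ (λ l → ℚΣ.*-distribˡ-sum (toℚ (A i l)) (λ k → c k * v k l)) ⟩
  ∑[ l < m ] ∑[ k < m ] (toℚ (A i l) * (c k * v k l))
    ≡⟨ ℚΣ.∑-comm (λ l k → toℚ (A i l) * (c k * v k l)) ⟩
  ∑[ k < m ] ∑[ l < m ] (toℚ (A i l) * (c k * v k l))
    ≡⟨ ℚΣ.sum-cong-≗ (λ k → ℚΣ.sum-cong-≗ (λ l → solve 3 (λ e c v → e :* (c :* v) := c :* (e :* v)) refl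
                                                          (toℚ (A i l)) (c k) (v k l))) ⟩
  ∑[ k < m ] ∑[ l < m ] (c k * (toℚ (A i l) * v k l))
    ≡⟨ ℚΣ.sum-cong-≗ (λ k → ℚΣ.*-distribˡ-sum (c k) (λ l → toℚ (A i l) * v k l)) ⟨
  ∑[ k < m ] (c k * (A ·ᵥ v k) i) ∎
  where
  open ≡-Reasoning
  open +-*-Solver

·ᵥ-reindex : ∀ {m} (A B : Matrix m) (α : Fin m → Fin m) (σ : Permutation′ m) →
             (∀ i j → B i j ≡ A (α i) (σ ⟨$⟩ʳ j)) →
             ∀ y → B ·ᵥ (λ j → y (σ ⟨$⟩ʳ j)) ≗ (λ i → (A ·ᵥ y) (α i))
·ᵥ-reindex {m} A B α σ B≡A y i = begin
  ∑[ j < m ] (toℚ (B i j) * y (σ ⟨$⟩ʳ j))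
    ≡⟨ ℚΣ.sum-cong-≗ (λ j → cong (λ e → toℚ e * y (σ ⟨$⟩ʳ j)) (B≡A i j)) ⟩
  ∑[ j < m ] (toℚ (A (α i) (σ ⟨$⟩ʳ j)) * y (σ ⟨$⟩ʳ j))
    ≡⟨ ℚΣ.∑-permute (λ l → toℚ (A (α i) l) * y l) σ ⟨
  (A ·ᵥ y) (α i) ∎
  where open ≡-Reasoning

P-hit : ∀ {m} (ρ : Permutation′ m) {i j} → ρ ⟨$⟩ʳ i ≡ j → P ρ i j ≡ 1ℤ
P-hit ρ {i} {j} ρi≡j = cong (if_then 1ℤ else 0ℤ) (dec-true (toℕ (ρ ⟨$⟩ʳ i) ℕ.≟ toℕ j) (cong toℕ ρi≡j))

P-miss : ∀ {m} (ρ : Permutation′ m) {i j} → ρ ⟨$⟩ʳ i ≢ j → P ρ i j ≡ 0ℤ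
P-miss ρ {i} {j} ρi≢j =
  cong (if_then 1ℤ else 0ℤ) (dec-false (toℕ (ρ ⟨$⟩ʳ i) ℕ.≟ toℕ j) (ρi≢j ∘ Fin.toℕ-injective))

P-·ˡ : ∀ {m} (ρ : Permutation′ m) (f : Fin m → ℤ) i → ΣFinℤ (λ l → P ρ i l ℤ.* f l) ≡ f (ρ ⟨$⟩ʳ i)
P-·ˡ ρ f i = begin
  ΣFinℤ (λ l → P ρ i l ℤ.* f l)                  ≡⟨ ΣFinℤ≡sum (λ l → P ρ i l ℤ.* f l) ⟩
  ℤΣ.sum (λ l → P ρ i l ℤ.* f l)
    ≡⟨ sum-single ℤ.+-*-semiring (ρ ⟨$⟩ʳ i) (λ l → P ρ i l ℤ.* f l) off-diagonal ⟩
  P ρ i (ρ ⟨$⟩ʳ i) ℤ.* f (ρ ⟨$⟩ʳ i)              ≡⟨ cong (ℤ._* f (ρ ⟨$⟩ʳ i)) (P-hit ρ refl) ⟩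
  1ℤ ℤ.* f (ρ ⟨$⟩ʳ i)                            ≡⟨ ℤ.*-identityˡ _ ⟩
  f (ρ ⟨$⟩ʳ i)                                   ∎
  where
  open ≡-Reasoning
  off-diagonal : ∀ l → l ≢ ρ ⟨$⟩ʳ i → P ρ i l ℤ.* f l ≡ 0ℤ
  off-diagonal l l≢ρi = trans (cong (ℤ._* f l) (P-miss ρ (l≢ρi ∘ sym))) (ℤ.*-zeroˡ (f l))

P-·ʳ : ∀ {m} (σ : Permutation′ m) (f : Fin m → ℤ) j → ΣFinℤ (λ k → f k ℤ.* P σ k j) ≡ f (σ ⟨$⟩ˡ j)
P-·ʳ σ f j = begin
  ΣFinℤ (λ k → f k ℤ.* P σ k j)                  ≡⟨ ΣFinℤ≡sum (λ k → f k ℤ.* P σ k j) ⟩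
  ℤΣ.sum (λ k → f k ℤ.* P σ k j)
    ≡⟨ sum-single ℤ.+-*-semiring (σ ⟨$⟩ˡ j) (λ k → f k ℤ.* P σ k j) off-diagonal ⟩
  f (σ ⟨$⟩ˡ j) ℤ.* P σ (σ ⟨$⟩ˡ j) j              ≡⟨ cong (f (σ ⟨$⟩ˡ j) ℤ.*_) (P-hit σ (inverseʳ σ)) ⟩
  f (σ ⟨$⟩ˡ j) ℤ.* 1ℤ                            ≡⟨ ℤ.*-identityʳ _ ⟩
  f (σ ⟨$⟩ˡ j)                                   ∎
  where
  open ≡-Reasoning
  off-diagonal : ∀ k → k ≢ σ ⟨$⟩ˡ j → f k ℤ.* P σ k j ≡ 0ℤ
  off-diagonal k k≢σ⁻¹j =
    trans (cong (f k ℤ.*_) (P-miss σ λ σk≡j → k≢σ⁻¹j (trans (sym (inverseˡ σ)) (cong (σ ⟨$⟩ˡ_) σk≡j))))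
          (ℤ.*-zeroʳ (f k))

P-conj : ∀ {m} (ρ σ : Permutation′ m) (A : Matrix m) i j → ((P (ρ ⁻¹) · A) · P σ) i j ≡ A (ρ ⟨$⟩ˡ i) (σ ⟨$⟩ˡ j)
P-conj ρ σ A i j = trans (P-·ʳ σ (λ k → (P (ρ ⁻¹) · A) i k) j) (P-·ˡ (ρ ⁻¹) (λ k → A k (σ ⟨$⟩ˡ j)) i)

-- The cone {x | p(x) = π}

L-entry : ∀ {m} (π : Permutation′ (suc m)) i j →
          toℚ (L π i j) ≡ 𝟙 (toℕ j <ᵇ toℕ (π ⟨$⟩ʳ fsuc i)) - 𝟙 (toℕ j <ᵇ toℕ (π ⟨$⟩ʳ inject₁ i))
L-entry π i j = signed-interval (toℕ (π ⟨$⟩ʳ inject₁ i)) (toℕ (π ⟨$⟩ʳ fsuc i)) (toℕ j)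
  where
  <ᵇ-suc : ∀ a c → (a <ᵇ suc c) ≡ (a ≤ᵇ c)
  <ᵇ-suc zero c = refl
  <ᵇ-suc (suc a) c = refl
  ≤ᵇ≡not<ᵇ : ∀ a c → (a ≤ᵇ c) ≡ not (c <ᵇ a)
  ≤ᵇ≡not<ᵇ zero c = refl
  ≤ᵇ≡not<ᵇ (suc a) zero = refl
  ≤ᵇ≡not<ᵇ (suc a) (suc c) = trans (<ᵇ-suc a c) (≤ᵇ≡not<ᵇ a c)
  by-cases : ∀ r p q → (T r → T p → T q) → (¬ T r → T q → T p) →
    toℚ (if r then (if not p ∧ q then 1ℤ else 0ℤ) else (if not q ∧ p then -1ℤ else 0ℤ)) ≡ 𝟙 q - 𝟙 p
  by-cases true  true  true  _ _ = refl
  by-cases true  true  false r∧p⇒q _ = ⊥-elim (r∧p⇒q tt tt)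
  by-cases true  false true  _ _ = refl
  by-cases true  false false _ _ = refl
  by-cases false true  true  _ _ = refl
  by-cases false true  false _ _ = refl
  by-cases false false true  _ ¬r∧q⇒p = ⊥-elim (¬r∧q⇒p (λ ()) tt)
  by-cases false false false _ _ = refl
  signed-interval : ∀ a b c →
    toℚ (if a <ᵇ b then (if (a ≤ᵇ c) ∧ (c <ᵇ b) then 1ℤ else 0ℤ) else (if (b ≤ᵇ c) ∧ (c <ᵇ a) then -1ℤ else 0ℤ))
      ≡ 𝟙 (c <ᵇ b) - 𝟙 (c <ᵇ a)
  signed-interval a b c rewrite ≤ᵇ≡not<ᵇ a c | ≤ᵇ≡not<ᵇ b c =
    by-cases (a <ᵇ b) (c <ᵇ a) (c <ᵇ b)
      (λ a<b c<a → ℕ.<⇒<ᵇ (ℕ.<-trans (ℕ.<ᵇ⇒< c a c<a) (ℕ.<ᵇ⇒< a b a<b)))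
      (λ a≮b c<b → ℕ.<⇒<ᵇ (ℕ.<-≤-trans (ℕ.<ᵇ⇒< c b c<b) (ℕ.≮⇒≥ (a≮b ∘ ℕ.<⇒<ᵇ))))

L-·ᵥ : ∀ {m} (π : Permutation′ (suc m)) y → L π ·ᵥ y ≗ Δ (λ k → Z y (π ⟨$⟩ʳ k))
L-·ᵥ {m} π y i = begin
  ∑[ j < m ] (toℚ (L π i j) * y j)                  ≡⟨ ℚΣ.sum-cong-≗ pointwise ⟩
  ∑[ j < m ] ([ j < b ] y j + - [ j < a ] y j)       ≡⟨ ℚΣ.∑-distrib-+ (λ j → [ j < b ] y j) (λ j → - [ j < a ] y j) ⟩
  ∑[ j < m ] [ j < b ] y j + ∑[ j < m ] (- [ j < a ] y j)
    ≡⟨ cong₂ _+_ (Z-as-sum y b) (trans (cong -_ (Z-as-sum y a)) (sym (sum-neg (λ j → [ j < a ] y j)))) ⟨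
  Z y b - Z y a                                     ∎
  where
  open ≡-Reasoning
  open +-*-Solver
  a b : Fin (suc m)
  a = π ⟨$⟩ʳ inject₁ i
  b = π ⟨$⟩ʳ fsuc i
  [_<_]_ : Fin m → Fin (suc m) → ℚ → ℚ
  [ j < v ] u = if toℕ j <ᵇ toℕ v then u else 0ℚ
  pointwise : ∀ j → toℚ (L π i j) * y j ≡ [ j < b ] y j + - [ j < a ] y j
  pointwise j = begin
    toℚ (L π i j) * y j                    ≡⟨ cong (_* y j) (L-entry π i j) ⟩
    (𝟙 q - 𝟙 p) * y j
      ≡⟨ solve 3 (λ q p u → (q :- p) :* u := q :* u :+ (:- (p :* u))) refl (𝟙 q) (𝟙 p) (y j) ⟩
    𝟙 q * y j + - (𝟙 p * y j)              ≡⟨ cong₂ (λ s t → s + - t) (𝟙-* q (y j)) (𝟙-* p (y j)) ⟩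
    [ j < b ] y j + - [ j < a ] y j        ∎
    where
    p q : Bool
    p = toℕ j <ᵇ toℕ a
    q = toℕ j <ᵇ toℕ b

-- When p(x) = π, π ⟨$⟩ˡ k is the position of the k-th smallest partial sum, so gap π x lists
-- the increments between consecutive sorted partial sums.
gap : ∀ {m} → Permutation′ (suc m) → (Fin m → ℚ) → Fin m → ℚ
gap π x = Δ (λ k → Z x (π ⟨$⟩ˡ k))

gap-cong : ∀ {m} (π : Permutation′ (suc m)) {x y} → x ≗ y → gap π x ≗ gap π y
gap-cong π x≗y = Δ-cong (λ k → Z-cong x≗y (π ⟨$⟩ˡ k))

gap-linear : ∀ {m} (π : Permutation′ (suc m)) t (a b : Fin m → ℚ) k →
             gap π (λ i → t * a i + b i) k ≡ t * gap π a k + gap π b k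
gap-linear {m} π t a b k = begin
  Z (λ i → t * a i + b i) hi - Z (λ i → t * a i + b i) lo  ≡⟨ cong₂ _-_ (Z-linear t a b hi) (Z-linear t a b lo) ⟩
  (t * Z a hi + Z b hi) - (t * Z a lo + Z b lo)
    ≡⟨ solve 5 (λ t p q r s → (t :* p :+ q) :- (t :* r :+ s) := t :* (p :- r) :+ (q :- s)) refl
               t (Z a hi) (Z b hi) (Z a lo) (Z b lo) ⟩
  t * gap π a k + gap π b k                                 ∎
  where
  open ≡-Reasoning
  open +-*-Solver
  lo hi : Fin (suc m)
  lo = π ⟨$⟩ˡ inject₁ k
  hi = π ⟨$⟩ˡ fsuc k

L-gap : ∀ {m} (π : Permutation′ (suc m)) x → L π ·ᵥ gap π x ≗ x
L-gap π x i = begin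
  (L π ·ᵥ gap π x) i                      ≡⟨ L-·ᵥ π (gap π x) i ⟩
  Δ (λ k → Z (gap π x) (π ⟨$⟩ʳ k)) i      ≡⟨ Δ-Z-Δ (λ k → Z x (π ⟨$⟩ˡ k)) (π ⟨$⟩ʳ_) i ⟩
  Δ (λ k → Z x (π ⟨$⟩ˡ (π ⟨$⟩ʳ k))) i     ≡⟨ Δ-cong (λ k → cong (Z x) (inverseˡ π {k})) i ⟩
  Δ (Z x) i                               ≡⟨ Δ-Z x i ⟩
  x i                                     ∎
  where open ≡-Reasoning

gap-L : ∀ {m} (π : Permutation′ (suc m)) y → gap π (L π ·ᵥ y) ≗ y
gap-L π y k = begin
  gap π (L π ·ᵥ y) k                                       ≡⟨ Δ-cong (λ v → Z-cong (L-·ᵥ π y) (π ⟨$⟩ˡ v)) k ⟩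
  Δ (λ v → Z (Δ (λ u → Z y (π ⟨$⟩ʳ u))) (π ⟨$⟩ˡ v)) k     ≡⟨ Δ-Z-Δ (λ u → Z y (π ⟨$⟩ʳ u)) (π ⟨$⟩ˡ_) k ⟩
  Δ (λ v → Z y (π ⟨$⟩ʳ (π ⟨$⟩ˡ v))) k                      ≡⟨ Δ-cong (λ v → cong (Z y) (inverseʳ π {v})) k ⟩
  Δ (Z y) k                                                ≡⟨ Δ-Z y k ⟩
  y k                                                      ∎
  where open ≡-Reasoning

L-·ᵥ-injective : ∀ {m} (π : Permutation′ (suc m)) {a b} → L π ·ᵥ a ≗ L π ·ᵥ b → a ≗ b
L-·ᵥ-injective π {a} {b} La≗Lb k = trans (sym (gap-L π a k)) (trans (gap-cong π La≗Lb k) (gap-L π b k))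

L-positive⇒PEq : ∀ {m} (π : Permutation′ (suc m)) y → (∀ j → 0ℚ < y j) → PEq (L π ·ᵥ y) π
L-positive⇒PEq π y y>0 = Ranks⇒PEq {π = π} λ a b πa<πb →
  subst₂ _<_ (sym (Z-L a)) (sym (Z-L b)) (ℚ.+-monoˡ-< (- Z y (π ⟨$⟩ʳ fzero)) (Z-strictMono y y>0 πa<πb))
  where
  Z-L : ∀ k → Z (L π ·ᵥ y) k ≡ Z y (π ⟨$⟩ʳ k) - Z y (π ⟨$⟩ʳ fzero)
  Z-L k = trans (Z-cong (L-·ᵥ π y) k) (Z-Δ (λ v → Z y (π ⟨$⟩ʳ v)) k)

PEq⇒gap-positive : ∀ {m} {π : Permutation′ (suc m)} {x} → PEq x π → ∀ k → 0ℚ < gap π x k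
PEq⇒gap-positive {m} {π} {x} pe k = subst (_< gap π x k) (ℚ.+-inverseʳ (Z x lo)) (ℚ.+-monoˡ-< (- Z x lo) lo<hi)
  where
  lo hi : Fin (suc m)
  lo = π ⟨$⟩ˡ inject₁ k
  hi = π ⟨$⟩ˡ fsuc k
  lo<hi : Z x lo < Z x hi
  lo<hi = PEq⇒Ranks {π = π} pe lo hi (subst₂ Fin._<_ (sym (inverseʳ π)) (sym (inverseʳ π)) (Fin.≤̄⇒inject₁< Fin.≤-refl))

L-column-injective : ∀ {m} (π : Permutation′ (suc m)) {a b} → (∀ i → L π i a ≡ L π i b) → a ≡ b
L-column-injective π {a} {b} same-column with a Fin.≟ b
... | yes a≡b = a≡b
... | no a≢b = ⊥-elim (ℚ.1≢0 (begin
  1ℚ      ≡⟨ δ-diagonal a ⟨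
  δ a a   ≡⟨ L-·ᵥ-injective π Lδa≗Lδb a ⟩
  δ b a   ≡⟨ δ-off-diagonal (a≢b ∘ sym) ⟩
  0ℚ      ∎))
  where
  open ≡-Reasoning
  Lδa≗Lδb : L π ·ᵥ δ a ≗ L π ·ᵥ δ b
  Lδa≗Lδb i = trans (·ᵥ-δ (L π) a i) (trans (cong toℚ (same-column i)) (sym (·ᵥ-δ (L π) b i)))

L-column≢0 : ∀ {m} (π : Permutation′ (suc m)) j → ∃ λ i → L π i j ≢ 0ℤ
L-column≢0 {m} π j = Fin.¬∀⟶∃¬ m (λ i → L π i j ≡ 0ℤ) (λ i → L π i j ℤ.≟ 0ℤ) λ column≡0 →
  ℚ.1≢0 (trans (sym (δ-diagonal j)) (L-·ᵥ-injective π (Lδ≗L0 column≡0) j))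
  where
  Lδ≗L0 : (∀ i → L π i j ≡ 0ℤ) → L π ·ᵥ δ j ≗ L π ·ᵥ (λ _ → 0ℚ)
  Lδ≗L0 column≡0 i = begin
    (L π ·ᵥ δ j) i                  ≡⟨ ·ᵥ-δ (L π) j i ⟩
    toℚ (L π i j)                   ≡⟨ cong toℚ (column≡0 i) ⟩
    0ℚ                              ≡⟨ ℚΣ.sum-replicate-zero m ⟨
    ∑[ l < m ] 0ℚ                   ≡⟨ ℚΣ.sum-cong-≗ (λ l → ℚ.*-zeroʳ (toℚ (L π i l))) ⟨
    (L π ·ᵥ (λ _ → 0ℚ)) i           ∎
    where open ≡-Reasoning

Sign : ℤ → Set
Sign e = e ≡ 1ℤ ⊎ e ≡ 0ℤ ⊎ e ≡ -1ℤ

L-sign : ∀ {m} (π : Permutation′ (suc m)) i j → Sign (L π i j)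
L-sign π i j = by-cases (a <ᵇ b) ((a ≤ᵇ c) ∧ (c <ᵇ b)) ((b ≤ᵇ c) ∧ (c <ᵇ a))
  where
  a = toℕ (π ⟨$⟩ʳ inject₁ i)
  b = toℕ (π ⟨$⟩ʳ fsuc i)
  c = toℕ j
  by-cases : ∀ r p q → Sign (if r then (if p then 1ℤ else 0ℤ) else (if q then -1ℤ else 0ℤ))
  by-cases true  true  _     = inj₁ refl
  by-cases true  false _     = inj₂ (inj₁ refl)
  by-cases false _     true  = inj₂ (inj₂ refl)
  by-cases false _     false = inj₂ (inj₁ refl)

sign-scaling≡1 : ∀ {e e′ s} → Sign e → Sign e′ → e ≢ 0ℤ → 0ℚ < s → toℚ e′ ≡ toℚ e * s → s ≡ 1ℚ
sign-scaling≡1 (inj₂ (inj₁ refl)) _ e≢0 _ _ = ⊥-elim (e≢0 refl)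
sign-scaling≡1 {s = s} (inj₁ refl) s′ _ s>0 eq = positive-sign (trans eq (ℚ.*-identityˡ s)) s′
  where
  positive-sign : ∀ {e′} → toℚ e′ ≡ s → Sign e′ → s ≡ 1ℚ
  positive-sign e′≡s (inj₁ refl) = sym e′≡s
  positive-sign e′≡s (inj₂ (inj₁ refl)) = ⊥-elim (ℚ.<-irrefl e′≡s s>0)
  positive-sign e′≡s (inj₂ (inj₂ refl)) = ⊥-elim (ℚ.<-asym s>0 (subst (_< 0ℚ) e′≡s (ℚ.negative⁻¹ (- 1ℚ))))
sign-scaling≡1 {s = s} (inj₂ (inj₂ refl)) s′ _ s>0 eq = negative-sign (trans eq (-1*x≈-x s)) s′
  where
  negative-sign : ∀ {e′} → toℚ e′ ≡ - s → Sign e′ → s ≡ 1ℚ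
  negative-sign e′≡-s (inj₁ refl) =
    ⊥-elim (ℚ.<-asym (ℚ.neg-antimono-< s>0) (subst (0ℚ <_) e′≡-s (ℚ.positive⁻¹ 1ℚ)))
  negative-sign e′≡-s (inj₂ (inj₁ refl)) = ⊥-elim (ℚ.<-irrefl (sym e′≡-s) (ℚ.neg-antimono-< s>0))
  negative-sign e′≡-s (inj₂ (inj₂ refl)) = sym (ℚ.neg-injective e′≡-s)

-- Matrix equivalence implies ∼

PEq-reindex : ∀ {m} {π τ : Permutation′ (suc m)} (α : Fin m → Fin m) (σ : Permutation′ m) →
              (∀ i j → L τ i j ≡ L π (α i) (σ ⟨$⟩ʳ j)) → ∀ x → PEq x π → PEq (λ i → x (α i)) τ
PEq-reindex {m} {π} {τ} α σ Lτ≡Lπ x pe =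
  PEq-cong {π = τ} reindexed (L-positive⇒PEq τ y (λ j → PEq⇒gap-positive {π = π} pe (σ ⟨$⟩ʳ j)))
  where
  y : Fin m → ℚ
  y j = gap π x (σ ⟨$⟩ʳ j)
  reindexed : L τ ·ᵥ y ≗ (λ i → x (α i))
  reindexed i = trans (·ᵥ-reindex (L π) (L τ) α σ Lτ≡Lπ (gap π x) i) (L-gap π x (α i))

equivalent⇒∼ : ∀ {m} (π τ : Permutation′ (suc m)) (σ ρ : Permutation′ m) →
               ((P (ρ ⁻¹) · L π) · P σ) ≋ L τ → π ∼ τ
equivalent⇒∼ π τ σ ρ PLP≋L = flip ρ , λ x →
  PEq-reindex {π = π} {τ} (ρ ⟨$⟩ˡ_) (flip σ) Lτ≡Lπ x ,
  λ pe → PEq-cong {π = π} (λ i → cong x (inverseˡ ρ {i}))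
                          (PEq-reindex {π = τ} {π} (ρ ⟨$⟩ʳ_) σ Lπ≡Lτ (λ i → x (ρ ⟨$⟩ˡ i)) pe)
  where
  Lτ≡Lπ : ∀ i j → L τ i j ≡ L π (ρ ⟨$⟩ˡ i) (σ ⟨$⟩ˡ j)
  Lτ≡Lπ i j = trans (sym (PLP≋L i j)) (P-conj ρ σ (L π) i j)
  Lπ≡Lτ : ∀ i j → L π i j ≡ L τ (ρ ⟨$⟩ʳ i) (σ ⟨$⟩ʳ j)
  Lπ≡Lτ i j = trans (cong₂ (L π) (sym (inverseˡ ρ)) (sym (inverseˡ σ))) (sym (Lτ≡Lπ (ρ ⟨$⟩ʳ i) (σ ⟨$⟩ʳ j)))

-- ∼ implies matrix equivalence

0<t*a+b⇒0≤b : ∀ a b → (∀ t → 0ℚ < t → 0ℚ < t * a + b) → 0ℚ ≤ b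
0<t*a+b⇒0≤b a b 0<t*a+b with 0ℚ ℚ.≤? b
... | yes 0≤b = 0≤b
... | no 0≰b with a ℚ.≤? 0ℚ
...   | yes a≤0 = ⊥-elim (ℚ.<-asym (0<t*a+b 1ℚ (ℚ.positive⁻¹ 1ℚ)) 1*a+b<0)
  where
  1*a+b<0 : 1ℚ * a + b < 0ℚ
  1*a+b<0 = ℚ.+-mono-≤-< (subst (_≤ 0ℚ) (sym (ℚ.*-identityˡ a)) a≤0) (ℚ.≰⇒> 0≰b)
...   | no a≰0 = ⊥-elim (ℚ.<-irrefl (sym t*a+b≡0) (0<t*a+b t t>0))
  where
  instance
    a-positive : ℚ.Positive a
    a-positive = ℚ.positive (ℚ.≰⇒> a≰0)
    a-nonZero : ℚ.NonZero a
    a-nonZero = ℚ.pos⇒nonZero a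
    -b-positive : ℚ.Positive (- b)
    -b-positive = ℚ.positive (ℚ.neg-antimono-< (ℚ.≰⇒> 0≰b))
  t : ℚ
  t = - b * ℚ.1/ a
  t>0 : 0ℚ < t
  t>0 = ℚ.positive⁻¹ t {{ℚ.pos*pos⇒pos (- b) (ℚ.1/ a) {{ℚ.1/pos⇒pos a}}}}
  t*a+b≡0 : t * a + b ≡ 0ℚ
  t*a+b≡0 = begin
    - b * ℚ.1/ a * a + b      ≡⟨ cong (_+ b) (ℚ.*-assoc (- b) (ℚ.1/ a) a) ⟩
    - b * (ℚ.1/ a * a) + b    ≡⟨ cong (λ s → - b * s + b) (ℚ.*-inverseˡ a) ⟩
    - b * 1ℚ + b              ≡⟨ cong (_+ b) (ℚ.*-identityʳ (- b)) ⟩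
    - b + b                   ≡⟨ ℚ.+-inverseˡ b ⟩
    0ℚ                        ∎
    where open ≡-Reasoning

nonNeg∧≢0⇒pos : ∀ {p} → 0ℚ ≤ p → p ≢ 0ℚ → 0ℚ < p
nonNeg∧≢0⇒pos {p} p≥0 p≢0 =
  ℚ.positive⁻¹ p {{ℚ.nonNeg∧nonZero⇒pos p {{ℚ.nonNegative p≥0}} {{ℚ.≢-nonZero p≢0}}}}

nonNeg-inverse⇒monomial : ∀ {m} (X Y : Fin m → Fin m → ℚ) →
                          (∀ j k → 0ℚ ≤ X j k) → (∀ k l → 0ℚ ≤ Y k l) →
                          (∀ j l → ∑[ k < m ] (X j k * Y k l) ≡ δ j l) →
                          ∀ j → ∃ λ k → 0ℚ < Y k j × (∀ l → l ≢ j → Y k l ≡ 0ℚ)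
nonNeg-inverse⇒monomial {m} X Y X≥0 Y≥0 XY≡I j = k , nonNeg∧≢0⇒pos (Y≥0 k j) Ykj≢0 , Ykl≡0
  where
  XY≥0 : ∀ l k → 0ℚ ≤ X j k * Y k l
  XY≥0 l k = ℚ.nonNegative⁻¹ (X j k * Y k l)
    {{ℚ.nonNeg*nonNeg⇒nonNeg (X j k) {{ℚ.nonNegative (X≥0 j k)}} (Y k l) {{ℚ.nonNegative (Y≥0 k l)}}}}
  found : ∃ λ k → X j k * Y k j ≢ 0ℚ
  found = sum≢0⇒∃≢0 (λ k → X j k * Y k j) (λ sum≡0 → ℚ.1≢0 (trans (sym (trans (XY≡I j j) (δ-diagonal j))) sum≡0))
  k : Fin m
  k = proj₁ found
  Xjk>0 : 0ℚ < X j k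
  Xjk>0 = nonNeg∧≢0⇒pos (X≥0 j k) (λ Xjk≡0 → proj₂ found (trans (cong (_* Y k j) Xjk≡0) (ℚ.*-zeroˡ (Y k j))))
  Ykj≢0 : Y k j ≢ 0ℚ
  Ykj≢0 Ykj≡0 = proj₂ found (trans (cong (X j k *_) Ykj≡0) (ℚ.*-zeroʳ (X j k)))
  Ykl≡0 : ∀ l → l ≢ j → Y k l ≡ 0ℚ
  Ykl≡0 l l≢j = ℚ.≤-antisym (ℚ.*-cancelˡ-≤-pos (X j k) {{ℚ.positive Xjk>0}} XjkYkl≤Xjk*0) (Y≥0 k l)
    where
    XjkYkl≡0 : X j k * Y k l ≡ 0ℚ
    XjkYkl≡0 = nonNeg-sum≡0⇒≡0 (λ k′ → X j k′ * Y k′ l) (XY≥0 l) (trans (XY≡I j l) (δ-off-diagonal (l≢j ∘ sym))) k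
    XjkYkl≤Xjk*0 : X j k * Y k l ≤ X j k * 0ℚ
    XjkYkl≤Xjk*0 = ℚ.≤-reflexive (trans XjkYkl≡0 (sym (ℚ.*-zeroʳ (X j k))))

-- The matrix W = L(τ)⁻¹ R L(π) of the proof idea, stored by columns: transfer π τ ρ j k = W_{kj}.
transfer : ∀ {m} → Permutation′ (suc m) → Permutation′ (suc m) → Permutation′ m → Fin m → Fin m → ℚ
transfer π τ ρ j = gap τ (λ i → col (L π) j (ρ ⟨$⟩ʳ i))

-- Column j of L(π) is the limit, as t → 0⁺, of L(π)(t·1 + e_j), which lies in the open cone of π.
transfer-nonNeg : ∀ {m} (π τ : Permutation′ (suc m)) (ρ : Permutation′ m) →
                  (∀ x → PEq x π → PEq (λ i → x (ρ ⟨$⟩ʳ i)) τ) → ∀ j k → 0ℚ ≤ transfer π τ ρ j k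
transfer-nonNeg {m} π τ ρ π→τ j k = 0<t*a+b⇒0≤b (gap τ (λ i → u (ρ ⟨$⟩ʳ i)) k) (transfer π τ ρ j k) 0<t*a+b
  where
  u : Fin m → ℚ
  u = L π ·ᵥ (λ _ → 1ℚ)
  0<t*a+b : ∀ t → 0ℚ < t → 0ℚ < t * gap τ (λ i → u (ρ ⟨$⟩ʳ i)) k + transfer π τ ρ j k
  0<t*a+b t t>0 = subst (0ℚ <_) (gap-linear τ t (λ i → u (ρ ⟨$⟩ʳ i)) (λ i → col (L π) j (ρ ⟨$⟩ʳ i)) k)
                        (PEq⇒gap-positive {π = τ} (π→τ x (PEq-cong {π = π} Ly≗x (L-positive⇒PEq π y y>0))) k)
    where
    y : Fin m → ℚ
    y l = t * 1ℚ + δ j l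
    y>0 : ∀ l → 0ℚ < y l
    y>0 l = ℚ.+-mono-<-≤ (subst (0ℚ <_) (sym (ℚ.*-identityʳ t)) t>0) (δ-nonNeg (does (j Fin.≟ l)))
      where
      δ-nonNeg : ∀ b → 0ℚ ≤ 𝟙 b
      δ-nonNeg true = ℚ.nonNegative⁻¹ 1ℚ
      δ-nonNeg false = ℚ.≤-refl
    x : Fin m → ℚ
    x i = t * u i + col (L π) j i
    Ly≗x : L π ·ᵥ y ≗ x
    Ly≗x i = trans (·ᵥ-linear (L π) t (λ _ → 1ℚ) (δ j) i) (cong (t * u i +_) (·ᵥ-δ (L π) j i))

transfer-inverse : ∀ {m} (π τ : Permutation′ (suc m)) (ρ : Permutation′ m) →
                   ∀ j l → ∑[ k < m ] (transfer π τ ρ j k * transfer τ π (flip ρ) k l) ≡ δ j l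
transfer-inverse {m} π τ ρ j = L-·ᵥ-injective π same-image
  where
  W W′ : Fin m → Fin m → ℚ
  W = transfer π τ ρ
  W′ = transfer τ π (flip ρ)
  same-image : L π ·ᵥ (λ l → ∑[ k < m ] (W j k * W′ k l)) ≗ L π ·ᵥ δ j
  same-image i = begin
    (L π ·ᵥ (λ l → ∑[ k < m ] (W j k * W′ k l))) i   ≡⟨ ·ᵥ-combination (L π) (W j) W′ i ⟩
    ∑[ k < m ] (W j k * (L π ·ᵥ W′ k) i)              ≡⟨ ℚΣ.sum-cong-≗ (λ k → cong (W j k *_) (L-gap π _ i)) ⟩
    ∑[ k < m ] (W j k * col (L τ) k (ρ ⟨$⟩ˡ i))       ≡⟨ ℚΣ.sum-cong-≗ (λ k → ℚ.*-comm (W j k) _) ⟩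
    (L τ ·ᵥ W j) (ρ ⟨$⟩ˡ i)                           ≡⟨ L-gap τ _ (ρ ⟨$⟩ˡ i) ⟩
    col (L π) j (ρ ⟨$⟩ʳ (ρ ⟨$⟩ˡ i))                   ≡⟨ cong (col (L π) j) (inverseʳ ρ) ⟩
    col (L π) j i                                     ≡⟨ ·ᵥ-δ (L π) j i ⟨
    (L π ·ᵥ δ j) i                                    ∎
    where open ≡-Reasoning

column-transport : ∀ {m} (π τ : Permutation′ (suc m)) (ρ : Permutation′ m) →
                   (∀ x → PEq x π → PEq (λ i → x (ρ ⟨$⟩ʳ i)) τ) →
                   (∀ x → PEq x τ → PEq (λ i → x (ρ ⟨$⟩ˡ i)) π) →
                   ∀ j → ∃ λ k → ∀ i → L τ (ρ ⟨$⟩ˡ i) k ≡ L π i j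
column-transport {m} π τ ρ π→τ τ→π j = k , λ i → toℚ-injective (begin
  toℚ (L τ (ρ ⟨$⟩ˡ i) k)     ≡⟨ column-k i ⟩
  toℚ (L π i j) * W′ k j     ≡⟨ cong (toℚ (L π i j) *_) W′kj≡1 ⟩
  toℚ (L π i j) * 1ℚ         ≡⟨ ℚ.*-identityʳ _ ⟩
  toℚ (L π i j)              ∎)
  where
  open ≡-Reasoning
  W′ : Fin m → Fin m → ℚ
  W′ = transfer τ π (flip ρ)
  unit-row : ∃ λ k → 0ℚ < W′ k j × (∀ l → l ≢ j → W′ k l ≡ 0ℚ)
  unit-row = nonNeg-inverse⇒monomial (transfer π τ ρ) W′
               (transfer-nonNeg π τ ρ π→τ) (transfer-nonNeg τ π (flip ρ) τ→π) (transfer-inverse π τ ρ) j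
  k : Fin m
  k = proj₁ unit-row
  column-k : ∀ i → toℚ (L τ (ρ ⟨$⟩ˡ i) k) ≡ toℚ (L π i j) * W′ k j
  column-k i = trans (sym (L-gap π _ i))
                     (sum-single ℚ-semiring j (λ l → toℚ (L π i l) * W′ k l)
                        (λ l l≢j → trans (cong (toℚ (L π i l) *_) (proj₂ (proj₂ unit-row) l l≢j))
                                         (ℚ.*-zeroʳ (toℚ (L π i l)))))
  i₀ : Fin m
  i₀ = proj₁ (L-column≢0 π j)
  W′kj≡1 : W′ k j ≡ 1ℚ
  W′kj≡1 = sign-scaling≡1 (L-sign π i₀ j) (L-sign τ (ρ ⟨$⟩ˡ i₀) k) (proj₂ (L-column≢0 π j))
                          (proj₁ (proj₂ unit-row)) (column-k i₀)

∼⇒equivalent : ∀ {m} (π τ : Permutation′ (suc m)) → π ∼ τ →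
               Σ (Permutation′ m) λ σ → Σ (Permutation′ m) λ ρ → ((P (ρ ⁻¹) · L π) · P σ) ≋ L τ
∼⇒equivalent {m} π τ (ρ , π⇔τ) = σ , flip ρ , λ i k → trans (P-conj (flip ρ) σ (L π) i k) (proj₂ (γ k) i)
  where
  π→τ : ∀ x → PEq x π → PEq (λ i → x (ρ ⟨$⟩ʳ i)) τ
  π→τ x = proj₁ (π⇔τ x)
  τ→π : ∀ x → PEq x τ → PEq (λ i → x (ρ ⟨$⟩ˡ i)) π
  τ→π x pe = proj₂ (π⇔τ (λ i → x (ρ ⟨$⟩ˡ i))) (PEq-cong {π = τ} (λ i → cong x (sym (inverseˡ ρ))) pe)
  β : ∀ j → ∃ λ k → ∀ i → L τ (ρ ⟨$⟩ˡ i) k ≡ L π i j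
  β = column-transport π τ ρ π→τ τ→π
  γ : ∀ k → ∃ λ j → ∀ i → L π (ρ ⟨$⟩ʳ i) j ≡ L τ i k
  γ = column-transport τ π (flip ρ) τ→π π→τ
  βγ : ∀ k → proj₁ (β (proj₁ (γ k))) ≡ k
  βγ k = L-column-injective τ λ i → begin
    L τ i _                          ≡⟨ cong (λ i′ → L τ i′ _) (inverseˡ ρ) ⟨
    L τ (ρ ⟨$⟩ˡ (ρ ⟨$⟩ʳ i)) _        ≡⟨ proj₂ (β _) (ρ ⟨$⟩ʳ i) ⟩
    L π (ρ ⟨$⟩ʳ i) (proj₁ (γ k))     ≡⟨ proj₂ (γ k) i ⟩
    L τ i k                          ∎
    where open ≡-Reasoning
  γβ : ∀ j → proj₁ (γ (proj₁ (β j))) ≡ j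
  γβ j = L-column-injective π λ i → begin
    L π i _                          ≡⟨ cong (λ i′ → L π i′ _) (inverseʳ ρ) ⟨
    L π (ρ ⟨$⟩ʳ (ρ ⟨$⟩ˡ i)) _        ≡⟨ proj₂ (γ _) (ρ ⟨$⟩ˡ i) ⟩
    L τ (ρ ⟨$⟩ˡ i) (proj₁ (β j))     ≡⟨ proj₂ (β j) i ⟩
    L π i j                          ∎
    where open ≡-Reasoning
  σ : Permutation′ m
  σ = permutation (proj₁ ∘ β) (proj₁ ∘ γ) βγ γβ

lemma2p3 : ∀ (m : ℕ) → 1 ℕ.≤ m → (π τ : Permutation′ (suc m)) →
    (π ∼ τ → Σ (Permutation′ m) λ σ → Σ (Permutation′ m) λ ρ → ((P (ρ ⁻¹) · L π) · P σ) ≋ L τ)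
    × ((Σ (Permutation′ m) λ σ → Σ (Permutation′ m) λ ρ → ((P (ρ ⁻¹) · L π) · P σ) ≋ L τ) → π ∼ τ)
lemma2p3 m _ π τ = ∼⇒equivalent π τ , λ (σ , ρ , PLP≋L) → equivalent⇒∼ π τ σ ρ PLP≋L
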